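{- For any $k,h\in\mathbb{N}$ there exists a graph $G$ such that $G\notin\mathrm{TD}_k$ and $G\notin\mathrm{MW}_h$, but $G\in\mathrm{MTD}_3$.
   Context: Graphs are finite and simple. Operations: $\circ,\bullet$ return the empty and the one-vertex graph; $\mathrm{Union}_t$ ($t\ge2$) is disjoint union; $\mathrm{Join}_t$ is disjoint union plus all edges between different arguments; $\mathrm{Inc}_{x,E_x}(G)=(V\cup\{x\},E\cup E_x)$ for $G=(V,E)$, $x\notin V$, $E_x\subseteq\{\{x,v\}\mid v\in V\}$; $\mathrm{Subst}_H(G_1,\dots,G_t)$ for $V(H)=\{v_1,\dots,v_t\}$ replaces each $v_i$ by a disjoint copy of $G_i$ and adds all edges between $V(G_i)$ and $V(G_j)$ whenever $\{v_i,v_j\}\in E(H)$. A graph has an algebraic expression over a set of operations if it is (up to renaming) the value of it; the empty graph corresponds to the empty expression. The nesting depth of an operation is the maximum number of expression-tree nodes labelled by it on a root-to-leaf path. $\mathrm{td}(G)$ is the least $k$ such that $G$ has an expression over $\{\circ,\mathrm{Union}\}\cup\{\mathrm{Inc}_{x,E_x}\}$ with $\mathrm{Inc}$ nesting depth at most $k$, and $\mathrm{TD}_k=\{G\mid\mathrm{td}(G)\le k\}$. $\mathrm{MW}_h$: graphs with an expression over $\{\bullet,\mathrm{Union},\mathrm{Join}\}\cup\{\mathrm{Subst}_H\mid|V(H)|\le h\}$. $\mathrm{MTD}_\ell$: graphs with an expression over $\{\bullet,\mathrm{Union},\mathrm{Join}\}\cup\{\mathrm{Subst}_H\mid\mathrm{td}(H)\le\ell\}$.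 -}

module Defs where

open import Data.Nat using (ℕ; zero; suc; _≤_; _⊔_)
open import Data.Fin using (Fin; zero; suc)
open import Data.Bool using (Bool; true; false)
open import Data.Empty using (⊥)
open import Data.Unit using (⊤)
open import Data.Maybe using (Maybe; just; nothing)
open import Data.Product using (Σ; _×_; _,_)
open import Data.Sum using (_⊎_)
open import Relation.Binary.PropositionalEquality using (_≡_; _≢_)
open import Relation.Nullary using (¬_)
open import Function.Bundles using (_⇔_)

record Graph : Set where
  field
    n      : ℕ
    adj    : Fin n → Fin n → Bool
    sym    : ∀ u v → adj u v ≡ adj v u
    irrefl : ∀ v → adj v v ≡ false

open Graph public

-- Algebraic expressions (syntax trees) over all the operations of the
-- paper.  'Vtx e' is the vertex set of the value of e (a finite type),
-- defined by induction–recursion.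
--   circ          : the empty graph
--   bullet        : the one-vertex graph
--   union t _ es  : Union_t (t ≥ 2), disjoint union of the values of es
--   join  t _ es  : Join_t  (t ≥ 2)
--   inc e E       : Inc_{x,E_x}; new vertex x ('nothing'), joined to
--                   exactly those old vertices v with E v ≡ true
--   subst H es    : Subst_H(G_1,…,G_t), V(H) = Fin t

mutual
  data Expr : Set where
    circ   : Expr
    bullet : Expr
    union  : (t : ℕ) → 2 ≤ t → (Fin t → Expr) → Expr
    join   : (t : ℕ) → 2 ≤ t → (Fin t → Expr) → Expr
    inc    : (e : Expr) → (Vtx e → Bool) → Expr
    subst  : (H : Graph) → (Fin (n H) → Expr) → Expr

  Vtx : Expr → Set
  Vtx circ          = ⊥
  Vtx bullet        = ⊤
  Vtx (union t _ es) = Σ (Fin t) (λ i → Vtx (es i))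
  Vtx (join t _ es)  = Σ (Fin t) (λ i → Vtx (es i))
  Vtx (inc e E)     = Maybe (Vtx e)
  Vtx (subst H es)  = Σ (Fin (n H)) (λ i → Vtx (es i))

data Adj : (e : Expr) → Vtx e → Vtx e → Set where
  union-in  : ∀ {t p es i a b} → Adj (es i) a b → Adj (union t p es) (i , a) (i , b)
  join-in   : ∀ {t p es i a b} → Adj (es i) a b → Adj (join t p es) (i , a) (i , b)
  join-out  : ∀ {t p es i j a b} → i ≢ j → Adj (join t p es) (i , a) (j , b)
  inc-old   : ∀ {e E a b} → Adj e a b → Adj (inc e E) (just a) (just b)
  inc-newˡ  : ∀ {e E a} → E a ≡ true → Adj (inc e E) nothing (just a)
  inc-newʳ  : ∀ {e E a} → E a ≡ true → Adj (inc e E) (just a) nothing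
  subst-in  : ∀ {H es i a b} → Adj (es i) a b → Adj (subst H es) (i , a) (i , b)
  subst-out : ∀ {H es i j a b} → adj H i j ≡ true → Adj (subst H es) (i , a) (j , b)

record Realises (G : Graph) (e : Expr) : Set where
  field
    to      : Fin (n G) → Vtx e
    from    : Vtx e → Fin (n G)
    from-to : ∀ u → from (to u) ≡ u
    to-from : ∀ x → to (from x) ≡ x
    adj-iff : ∀ u v → (adj G u v ≡ true) ⇔ Adj e (to u) (to v)

-- G has an expression whose operations satisfy Ok; the empty graph
-- corresponds to the empty expression.
HasExpr : (Expr → Set) → Graph → Set
HasExpr Ok G = (n G ≡ 0) ⊎ Σ Expr (λ e → Ok e × Realises G e)

maxFin : (t : ℕ) → (Fin t → ℕ) → ℕ
maxFin zero    f = 0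
maxFin (suc t) f = f zero ⊔ maxFin t (λ i → f (suc i))

incDepth : Expr → ℕ
incDepth circ           = 0
incDepth bullet         = 0
incDepth (union t _ es) = maxFin t (λ i → incDepth (es i))
incDepth (join t _ es)  = maxFin t (λ i → incDepth (es i))
incDepth (inc e E)      = suc (incDepth e)
incDepth (subst H es)   = maxFin (n H) (λ i → incDepth (es i))

TDOps : Expr → Set
TDOps circ           = ⊤
TDOps bullet         = ⊥
TDOps (union t _ es) = ∀ i → TDOps (es i)
TDOps (join t _ es)  = ⊥
TDOps (inc e E)      = TDOps e
TDOps (subst H es)   = ⊥

InTD : ℕ → Graph → Set
InTD k = HasExpr (λ e → TDOps e × incDepth e ≤ k)

MWOps : ℕ → Expr → Set
MWOps h circ           = ⊥
MWOps h bullet         = ⊤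
MWOps h (union t _ es) = ∀ i → MWOps h (es i)
MWOps h (join t _ es)  = ∀ i → MWOps h (es i)
MWOps h (inc e E)      = ⊥
MWOps h (subst H es)   = (n H ≤ h) × (∀ i → MWOps h (es i))

InMW : ℕ → Graph → Set
InMW h = HasExpr (MWOps h)

MTDOps : ℕ → Expr → Set
MTDOps ℓ circ           = ⊥
MTDOps ℓ bullet         = ⊤
MTDOps ℓ (union t _ es) = ∀ i → MTDOps ℓ (es i)
MTDOps ℓ (join t _ es)  = ∀ i → MTDOps ℓ (es i)
MTDOps ℓ (inc e E)      = ⊥
MTDOps ℓ (subst H es)   = InTD ℓ H × (∀ i → MTDOps ℓ (es i))

InMTD : ℕ → Graph → Set
InMTD ℓ = HasExpr (MTDOps ℓ)

-- Take a spider P (a star with h + 2 edges, each subdivided once) and replace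
-- every vertex of P by a clique K_{k+2}. The result lies in MTD_3 because P has
-- tree-depth 3. It is not in TD_k: the Inc-level at which a vertex is created
-- properly colours any TD-expression with as many colours as its Inc nesting
-- depth, and the graph contains K_{k+2}. It is not in MW_h: P is prime and is an
-- induced subgraph, and a prime induced subgraph of Union/Join/Subst_H either
-- lies inside one argument (recurse) or meets every argument at most once,
-- which for Subst_H forces |V(H)| ≥ h + 2.
{-# OPTIONS --safe #-}
module Submission where

open import Defs
open import Data.Nat using (ℕ; zero; suc; _+_; _≤_; _<_; z≤n; s≤s)
open import Data.Nat.Properties using (≤-trans; ≤-<-trans; n≤1+n; m≤m⊔n; m≤n⊔m; ⊔-lub; <⇒≱)
open import Data.Fin using (Fin; zero; suc; inject≤; inject₁; fromℕ; _≟_)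
open import Data.Fin.Properties
  using (0↔⊥; 1↔⊤; +↔⊎; ¬Fin0; inject≤-injective; inject₁-injective; fromℕ≢inject₁; injective⇒≤)
open import Data.Bool using (true)
import Data.Bool.Properties as Bool
import Data.Maybe.Properties as Maybe
open import Data.Empty using (⊥-elim)
open import Data.Unit using (tt)
open import Data.Maybe using (Maybe; just; nothing; maybe; is-just)
open import Data.Product using (Σ; _×_; _,_; proj₁; proj₂)
open import Data.Product.Properties using (Σ-≡,≡→≡) renaming (≡-dec to Σ-≡-dec)
open import Data.Sum using (_⊎_; inj₁; inj₂; [_,_])
open import Data.Sum.Function.Propositional using (_⊎-↔_)
open import Function using (_∘_)
open import Function.Bundles using (_⇔_; mk⇔; Equivalence; _↔_; mk↔ₛ′; Inverse; _↣_; Injection; mk↣)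
open import Function.Definitions using (Injective)
open import Function.Properties.Inverse using (↔-trans)
open import Function.Properties.Equivalence using () renaming (trans to ⇔-trans; sym to ⇔-sym)
open import Level using (0ℓ)
open import Relation.Binary using (Rel; DecidableEquality)
open import Relation.Binary.PropositionalEquality
  using (_≡_; _≢_; refl; trans; cong; subst₂)
  renaming (sym to ≡-sym; subst to ≡-subst)
open import Relation.Nullary using (¬_; Dec; yes; no; does; contradiction)
open import Relation.Nullary.Decidable using (dec-true; dec-false)
import Relation.Nullary.Decidable as Dec
open import Relation.Unary using (Pred; Decidable)

open Equivalence using (to; from)

loop-free : ∀ H {i} → ¬ adj H i i ≡ true
loop-free H {i} loop with () ← trans (≡-sym loop) (irrefl H i)

Adj-sym : ∀ {e x y} → Adj e x y → Adj e y x
Adj-sym (union-in q)  = union-in (Adj-sym q)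
Adj-sym (join-in q)   = join-in (Adj-sym q)
Adj-sym (join-out ne) = join-out (ne ∘ ≡-sym)
Adj-sym (inc-old q)   = inc-old (Adj-sym q)
Adj-sym (inc-newˡ q)  = inc-newʳ q
Adj-sym (inc-newʳ q)  = inc-newˡ q
Adj-sym (subst-in q)  = subst-in (Adj-sym q)
Adj-sym {subst H es} {i , _} {j , _} (subst-out q) = subst-out (trans (Graph.sym H j i) q)

Adj-irrefl : ∀ {e x} → ¬ Adj e x x
Adj-irrefl (union-in q)  = Adj-irrefl q
Adj-irrefl (join-in q)   = Adj-irrefl q
Adj-irrefl (join-out ne) = ne refl
Adj-irrefl (inc-old q)   = Adj-irrefl q
Adj-irrefl (subst-in q)  = Adj-irrefl q
Adj-irrefl {subst H es} (subst-out q) = loop-free H q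

module _ {t : ℕ} {es : Fin t → Expr} {i : Fin t} {a b : Vtx (es i)} where

  union-in⇔ : ∀ {p} → Adj (es i) a b ⇔ Adj (union t p es) (i , a) (i , b)
  union-in⇔ = mk⇔ union-in λ { (union-in q) → q }

  join-in⇔ : ∀ {p} → Adj (es i) a b ⇔ Adj (join t p es) (i , a) (i , b)
  join-in⇔ = mk⇔ join-in λ { (join-in q) → q ; (join-out i≢i) → contradiction refl i≢i }

subst-in⇔ : ∀ {H es i} {a b : Vtx (es i)} → Adj (es i) a b ⇔ Adj (subst H es) (i , a) (i , b)
subst-in⇔ {H} = mk⇔ subst-in λ { (subst-in q) → q ; (subst-out q) → ⊥-elim (loop-free H q) }

Adj? : ∀ e x y → Dec (Adj e x y)
Adj? bullet _ _ = no λ ()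
Adj? (union t p es) (i , a) (j , b) with i ≟ j
... | yes refl = Dec.map union-in⇔ (Adj? (es i) a b)
... | no i≢j   = no λ { (union-in _) → i≢j refl }
Adj? (join t p es) (i , a) (j , b) with i ≟ j
... | yes refl = Dec.map join-in⇔ (Adj? (es i) a b)
... | no i≢j   = yes (join-out i≢j)
Adj? (inc e E) nothing  nothing  = no λ ()
Adj? (inc e E) nothing  (just b) = Dec.map′ inc-newˡ (λ { (inc-newˡ q) → q }) (E b Bool.≟ true)
Adj? (inc e E) (just a) nothing  = Dec.map′ inc-newʳ (λ { (inc-newʳ q) → q }) (E a Bool.≟ true)
Adj? (inc e E) (just a) (just b) = Dec.map′ inc-old (λ { (inc-old q) → q }) (Adj? e a b)
Adj? (subst H es) (i , a) (j , b) with i ≟ j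
... | yes refl = Dec.map subst-in⇔ (Adj? (es i) a b)
... | no i≢j   = Dec.map′ subst-out (λ { (subst-in _) → contradiction refl i≢j ; (subst-out q) → q })
                          (adj H i j Bool.≟ true)

∑ : (t : ℕ) → (Fin t → ℕ) → ℕ
∑ zero    f = 0
∑ (suc t) f = f zero + ∑ t (f ∘ suc)

Σ-Fin-suc-↔ : ∀ {t} {B : Fin (suc t) → Set} → (B zero ⊎ Σ (Fin t) (B ∘ suc)) ↔ Σ (Fin (suc t)) B
Σ-Fin-suc-↔ = mk↔ₛ′ [ zero ,_ , (λ (i , b) → suc i , b) ]
                     (λ { (zero , b) → inj₁ b ; (suc i , b) → inj₂ (i , b) })
                     (λ { (zero , b) → refl ; (suc i , b) → refl })
                     [ (λ _ → refl) , (λ _ → refl) ]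

Σ-↔ : ∀ {t} {f : Fin t → ℕ} {B : Fin t → Set} → (∀ i → Fin (f i) ↔ B i) → Fin (∑ t f) ↔ Σ (Fin t) B
Σ-↔ {zero}  _  = mk↔ₛ′ (λ ()) (λ { (() , _) }) (λ { (() , _) }) (λ ())
Σ-↔ {suc t} eq = ↔-trans +↔⊎ (↔-trans (eq zero ⊎-↔ Σ-↔ (eq ∘ suc)) Σ-Fin-suc-↔)

suc-↔ : ∀ {m} {A : Set} → Fin m ↔ A → Fin (suc m) ↔ Maybe A
suc-↔ eq = mk↔ₛ′ (λ { zero → nothing ; (suc i) → just (Inverse.to eq i) })
                 (maybe (suc ∘ Inverse.from eq) zero)
                 (λ { nothing → refl ; (just a) → cong just (Inverse.strictlyInverseˡ eq a) })
                 (λ { zero → refl ; (suc i) → cong suc (Inverse.strictlyInverseʳ eq i) })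

size : Expr → ℕ
size circ           = 0
size bullet         = 1
size (union t _ es) = ∑ t (λ i → size (es i))
size (join t _ es)  = ∑ t (λ i → size (es i))
size (inc e _)      = suc (size e)
size (subst H es)   = ∑ (n H) (λ i → size (es i))

enumerate : ∀ e → Fin (size e) ↔ Vtx e
enumerate circ           = 0↔⊥
enumerate bullet         = 1↔⊤
enumerate (union t _ es) = Σ-↔ (λ i → enumerate (es i))
enumerate (join t _ es)  = Σ-↔ (λ i → enumerate (es i))
enumerate (inc e _)      = suc-↔ (enumerate e)
enumerate (subst H es)   = Σ-↔ (λ i → enumerate (es i))

does-true⇒ : ∀ {A : Set} (a? : Dec A) → does a? ≡ true → A
does-true⇒ (yes a) _ = a

does-sym : ∀ e x y → does (Adj? e x y) ≡ does (Adj? e y x)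
does-sym e x y with Adj? e x y
... | yes xy = ≡-sym (dec-true (Adj? e y x) (Adj-sym xy))
... | no ¬xy = ≡-sym (dec-false (Adj? e y x) (¬xy ∘ Adj-sym))

graph : Expr → Graph
graph e = record
  { n      = size e
  ; adj    = λ u v → does (Adj? e (to′ u) (to′ v))
  ; sym    = λ u v → does-sym e (to′ u) (to′ v)
  ; irrefl = λ v → dec-false (Adj? e (to′ v) (to′ v)) Adj-irrefl
  }
  where
  to′ : Fin (size e) → Vtx e
  to′ = Inverse.to (enumerate e)

graph-realises : ∀ e → Realises (graph e) e
graph-realises e = record
  { to      = Inverse.to (enumerate e)
  ; from    = Inverse.from (enumerate e)
  ; from-to = Inverse.strictlyInverseʳ (enumerate e)
  ; to-from = Inverse.strictlyInverseˡ (enumerate e)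
  ; adj-iff = λ u v → mk⇔ (does-true⇒ (Adj? e _ _)) (dec-true (Adj? e _ _))
  }

record _⊑_ {A B : Set} (R : Rel A 0ℓ) (S : Rel B 0ℓ) : Set where
  field
    map  : A → B
    adj⇔ : ∀ x y → R x y ⇔ S (map x) (map y)

open _⊑_

infixr 9 _⊚_

_⊚_ : ∀ {A B C : Set} {R : Rel A 0ℓ} {S : Rel B 0ℓ} {T : Rel C 0ℓ} → R ⊑ S → S ⊑ T → R ⊑ T
f ⊚ g = record { map = map g ∘ map f ; adj⇔ = λ x y → ⇔-trans (adj⇔ f x y) (adj⇔ g _ _) }

Edge : (G : Graph) → Rel (Fin (n G)) 0ℓ
Edge G u v = adj G u v ≡ true

realises⇒⊒ : ∀ {G e} → Realises G e → Edge G ⊑ Adj e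
realises⇒⊒ R = record { map = Realises.to R ; adj⇔ = Realises.adj-iff R }

realises⇒⊑ : ∀ {G e} → Realises G e → Adj e ⊑ Edge G
realises⇒⊑ {G} {e} R = record { map = from′ ; adj⇔ = λ x y → ⇔-sym (adj⇔-from x y) }
  where
  open Realises R using (adj-iff; to-from) renaming (from to from′)
  adj⇔-from : ∀ x y → Edge G (from′ x) (from′ y) ⇔ Adj e x y
  adj⇔-from x y = subst₂ (λ a b → Edge G (from′ x) (from′ y) ⇔ Adj e a b)
                         (to-from x) (to-from y) (adj-iff (from′ x) (from′ y))

subst-part-⊑ : ∀ {H es} i → Adj (es i) ⊑ Adj (subst H es)
subst-part-⊑ i = record { map = i ,_ ; adj⇔ = λ _ _ → subst-in⇔ }

subst-transversal-⊑ : ∀ {H es} → (∀ i → Vtx (es i)) → Edge H ⊑ Adj (subst H es)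
subst-transversal-⊑ a = record
  { map  = λ i → i , a i
  ; adj⇔ = λ _ _ → mk⇔ subst-out λ { (subst-in q) → ⊥-elim (Adj-irrefl q) ; (subst-out q) → q }
  }

-- Tree-depth bounds the clique number

maxFin-≥ : ∀ t (f : Fin t → ℕ) i → f i ≤ maxFin t f
maxFin-≥ (suc t) f zero    = m≤m⊔n _ _
maxFin-≥ (suc t) f (suc i) = ≤-trans (maxFin-≥ t (f ∘ suc) i) (m≤n⊔m _ _)

maxFin-≤ : ∀ t (f : Fin t → ℕ) {b} → (∀ i → f i ≤ b) → maxFin t f ≤ b
maxFin-≤ zero    f f≤b = z≤n
maxFin-≤ (suc t) f f≤b = ⊔-lub (f≤b zero) (maxFin-≤ t (f ∘ suc) (f≤b ∘ suc))

colour : ∀ e → TDOps e → Vtx e → Fin (incDepth e)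
colour (union t _ es) ok (i , a) = inject≤ (colour (es i) (ok i) a) (maxFin-≥ t (λ j → incDepth (es j)) i)
colour (inc e _)      ok nothing  = fromℕ (incDepth e)
colour (inc e _)      ok (just a) = inject₁ (colour e ok a)

colour-proper : ∀ e ok {x y} → Adj e x y → colour e ok x ≢ colour e ok y
colour-proper (union t _ es) ok (union-in {i = i} q) = colour-proper (es i) (ok i) q ∘ inject≤-injective _ _ _ _
colour-proper (inc e _)      ok (inc-old q)  = colour-proper e ok q ∘ inject₁-injective
colour-proper (inc e _)      ok (inc-newˡ _) = fromℕ≢inject₁
colour-proper (inc e _)      ok (inc-newʳ _) = fromℕ≢inject₁ ∘ ≡-sym

clique≤incDepth : ∀ {r} e → TDOps e → _≢_ {A = Fin r} ⊑ Adj e → r ≤ incDepth e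
clique≤incDepth e ok f = injective⇒≤ colours-distinct
  where
  colours-distinct : Injective _≡_ _≡_ (colour e ok ∘ map f)
  colours-distinct {i} {j} same with i ≟ j
  ... | yes i≡j = i≡j
  ... | no i≢j  = ⊥-elim (colour-proper e ok (to (adj⇔ f i j) i≢j) same)

clique⇒∉TD : ∀ {k r} G → k < r → _≢_ {A = Fin r} ⊑ Edge G → ¬ InTD k G
clique⇒∉TD G (s≤s _) f (inj₁ empty) = ¬Fin0 (≡-subst Fin empty (map f zero))
clique⇒∉TD G k<r f (inj₂ (e , (ok , depth) , R)) =
  <⇒≱ (≤-<-trans depth k<r) (clique≤incDepth e ok (f ⊚ realises⇒⊒ R))

-- Modules and prime graphs

module _ {A : Set} (_∼_ : Rel A 0ℓ) where

  IsModule : Pred A 0ℓ → Set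
  IsModule M = ∀ {x y y′} → ¬ M x → M y → M y′ → x ∼ y → x ∼ y′

  -- Only decidable modules are quantified over; the partitions used below are decidable.
  IsPrime : Set₁
  IsPrime = ∀ {M} → Decidable M → IsModule M → ∀ {u v} → u ≢ v → M u → M v → ∀ w → M w

IsModule-preimage : ∀ {A B : Set} {R : Rel A 0ℓ} {S : Rel B 0ℓ} {M} →
                    (f : R ⊑ S) → IsModule S M → IsModule R (M ∘ map f)
IsModule-preimage f mod {x} {y} {y′} ¬Mx My My′ x∼y =
  from (adj⇔ f x y′) (mod ¬Mx My My′ (to (adj⇔ f x y) x∼y))

Part : ∀ {t} {B : Fin t → Set} → Fin t → Pred (Σ (Fin t) B) 0ℓ
Part i p = proj₁ p ≡ i

union-part-module : ∀ {t p es} i → IsModule (Adj (union t p es)) (Part i)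
union-part-module i ¬Mx My My′ (union-in _) = contradiction My ¬Mx

union-same-part : ∀ {t p es q q′} → Adj (union t p es) q q′ → proj₁ q ≡ proj₁ q′
union-same-part (union-in _) = refl

join-part-module : ∀ {t p es} i → IsModule (Adj (join t p es)) (Part i)
join-part-module i ¬Mx My My′ _ = join-out (¬Mx ∘ λ same → trans same My′)

subst-part-module : ∀ {H es} i → IsModule (Adj (subst H es)) (Part i)
subst-part-module i ¬Mx My My′ (subst-in _)  = contradiction My ¬Mx
subst-part-module i ¬Mx refl refl (subst-out q) = subst-out q

module PrimePattern {A : Set} {_∼_ : Rel A 0ℓ} (_≟ᴬ_ : DecidableEquality A) (prime : IsPrime _∼_)
  {t : ℕ} {B : Fin t → Set} {R : Rel (Σ (Fin t) B) 0ℓ} {Rᵢ : (i : Fin t) → Rel (B i) 0ℓ}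
  (part⇔ : ∀ {i a b} → Rᵢ i a b ⇔ R (i , a) (i , b)) (parts : ∀ i → IsModule R (Part i))
  (f : _∼_ ⊑ R) where

  restrict : ∀ {i} → (∀ x → proj₁ (map f x) ≡ i) → _∼_ ⊑ Rᵢ i
  restrict {i} inside = record
    { map  = component
    ; adj⇔ = λ x y → ⇔-trans (adj⇔ f x y) (⇔-sym (⇔-trans part⇔ (subst₂-⇔ (at x) (at y))))
    }
    where
    component : A → B i
    component x = ≡-subst B (inside x) (proj₂ (map f x))
    at : ∀ x → (i , component x) ≡ map f x
    at x = ≡-sym (Σ-≡,≡→≡ (inside x , refl))
    subst₂-⇔ : ∀ {p p′ q q′} → p ≡ p′ → q ≡ q′ → R p q ⇔ R p′ q′
    subst₂-⇔ refl refl = mk⇔ (λ r → r) (λ r → r)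

  parts-injective : (∀ i → ¬ (_∼_ ⊑ Rᵢ i)) → Injective _≡_ _≡_ (proj₁ ∘ map f)
  parts-injective ⋢parts {u} {v} same with u ≟ᴬ v
  ... | yes u≡v = u≡v
  ... | no u≢v  = ⊥-elim (⋢parts _ (restrict all-in-part))
    where
    all-in-part : ∀ w → proj₁ (map f w) ≡ proj₁ (map f v)
    all-in-part = prime (λ w → proj₁ (map f w) ≟ proj₁ (map f v))
                        (IsModule-preimage f (parts _)) u≢v same refl

module _ {A : Set} {_∼_ : Rel A 0ℓ} (_≟ᴬ_ : DecidableEquality A) (prime : IsPrime _∼_)
  {x y : A} (x∼y : x ∼ y) {x′ y′ : A} (x′≢y′ : x′ ≢ y′) (x′≁y′ : ¬ x′ ∼ y′)
  {m h : ℕ} (h<m : h < m) (ι : Fin m ↣ A) where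

  prime⋢MW : ∀ e → MWOps h e → ¬ (_∼_ ⊑ Adj e)
  prime⋢MW bullet _ f with () ← to (adj⇔ f x y) x∼y
  prime⋢MW (union t p es) ok f = Adj-irrefl (≡-subst (λ z → Adj _ (map f z) (map f y)) x≡y fxy)
    where
    open PrimePattern _≟ᴬ_ prime union-in⇔ union-part-module f
    fxy : Adj (union t p es) (map f x) (map f y)
    fxy = to (adj⇔ f x y) x∼y
    x≡y : x ≡ y
    x≡y = parts-injective (λ i → prime⋢MW (es i) (ok i)) (union-same-part fxy)
  prime⋢MW (join t p es) ok f = x′≁y′ (from (adj⇔ f x′ y′) (join-out (x′≢y′ ∘ inj)))
    where
    open PrimePattern _≟ᴬ_ prime join-in⇔ join-part-module f
    inj : Injective _≡_ _≡_ (proj₁ ∘ map f)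
    inj = parts-injective (λ i → prime⋢MW (es i) (ok i))
  prime⋢MW (subst H es) (|H|≤h , ok) f = <⇒≱ h<m (≤-trans (injective⇒≤ inj) |H|≤h)
    where
    open PrimePattern _≟ᴬ_ prime subst-in⇔ subst-part-module f
    inj : Injective _≡_ _≡_ (proj₁ ∘ map f ∘ Injection.to ι)
    inj = Injection.injective ι ∘ parts-injective (λ i → prime⋢MW (es i) (ok i))

  prime⇒∉MW : ∀ G → _∼_ ⊑ Edge G → ¬ InMW h G
  prime⇒∉MW G f (inj₁ empty)         = ¬Fin0 (≡-subst Fin empty (map f x))
  prime⇒∉MW G f (inj₂ (e , ok , R)) = prime⋢MW e ok (f ⊚ realises⇒⊒ R)

-- The spider: a star whose edges are subdivided once

leg : Expr
leg = inc (inc circ λ ()) (λ _ → true)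

spider : (m : ℕ) → 2 ≤ m → Expr
spider m p = inc (union m p (λ _ → leg)) (is-just ∘ proj₂)

pattern centre = nothing
pattern mid i  = just (i , just nothing)
pattern leaf i = just (i , nothing)

another : ∀ {m} → 2 ≤ m → Fin m → Fin m
another (s≤s (s≤s _)) zero    = suc zero
another (s≤s (s≤s _)) (suc _) = zero

another-≢ : ∀ {m} (p : 2 ≤ m) i → another p i ≢ i
another-≢ (s≤s (s≤s _)) zero    ()
another-≢ (s≤s (s≤s _)) (suc _) ()

module _ {m : ℕ} (p : 2 ≤ m) where

  private
    _∼_ : Rel (Vtx (spider m p)) 0ℓ
    _∼_ = Adj (spider m p)

  spider-≟ : DecidableEquality (Vtx (spider m p))
  spider-≟ = Maybe.≡-dec (Σ-≡-dec _≟_ (Maybe.≡-dec (Maybe.≡-dec λ ())))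

  leaves : Fin m ↣ Vtx (spider m p)
  leaves = mk↣ {to = λ i → leaf i} λ { refl → refl }

  centre∼mid : ∀ {i} → centre ∼ mid i
  centre∼mid = inc-newˡ refl

  mid∼centre : ∀ {i} → mid i ∼ centre
  mid∼centre = inc-newʳ refl

  mid∼leaf : ∀ {i} → mid i ∼ leaf i
  mid∼leaf = inc-old (union-in (inc-newʳ refl))

  leaf∼mid : ∀ {i} → leaf i ∼ mid i
  leaf∼mid = inc-old (union-in (inc-newˡ refl))

  centre≁leaf : ∀ {i} → ¬ centre ∼ leaf i
  centre≁leaf (inc-newˡ ())

  leaf≁centre : ∀ {i} → ¬ leaf i ∼ centre
  leaf≁centre (inc-newʳ ())

  legs-apart : ∀ {i j a b} → i ≢ j → ¬ just (i , a) ∼ just (j , b)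
  legs-apart i≢j (inc-old (union-in _)) = i≢j refl

  module SpiderModule {M : Pred (Vtx (spider m p)) 0ℓ} (M? : Decidable M) (mod : IsModule _∼_ M) where

    in-M : ∀ {x y y′} → M y → M y′ → x ∼ y → ¬ x ∼ y′ → M x
    in-M {x} My My′ x∼y x≁y′ with M? x
    ... | yes Mx = Mx
    ... | no ¬Mx = contradiction (mod ¬Mx My My′ x∼y) x≁y′

    centre-mid⇒all : ∀ {i} → M centre → M (mid i) → ∀ w → M w
    centre-mid⇒all {i} Mc Mmi = all
      where
      all-mid : ∀ j → M (mid j)
      all-mid j with j ≟ i
      ... | yes refl = Mmi
      ... | no j≢i   = in-M Mc (in-M Mmi Mc leaf∼mid leaf≁centre) mid∼centre (legs-apart j≢i)
      all : ∀ w → M w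
      all centre   = Mc
      all (mid j)  = all-mid j
      all (leaf j) = in-M (all-mid j) Mc leaf∼mid leaf≁centre
      all (just (_ , just (just ())))

    centre∈ : ∀ {u v} → u ≢ v → M u → M v → M centre
    centre∈ {centre} _ Mu _ = Mu
    centre∈ {just _} {centre} _ _ Mv = Mv
    centre∈ {mid i}  {mid j}  u≢v Mu Mv =
      in-M Mv (in-M Mu Mv leaf∼mid (legs-apart λ { refl → u≢v refl })) centre∼mid centre≁leaf
    centre∈ {mid i}  {leaf j} _ Mu Mv = in-M Mu Mv centre∼mid centre≁leaf
    centre∈ {leaf i} {mid j}  _ Mu Mv = in-M Mv Mu centre∼mid centre≁leaf
    centre∈ {leaf i} {leaf j} u≢v Mu Mv =
      in-M (in-M Mu Mv mid∼leaf (legs-apart λ { refl → u≢v refl })) Mv centre∼mid centre≁leaf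
    centre∈ {just (_ , just (just ()))}
    centre∈ {just _} {just (_ , just (just ()))}

    centre-other⇒all : ∀ {u} → M centre → M u → u ≢ centre → ∀ w → M w
    centre-other⇒all {centre} _  _  u≢c = contradiction refl u≢c
    centre-other⇒all {mid i}  Mc Mu _   = centre-mid⇒all Mc Mu
    centre-other⇒all {leaf i} Mc Mu _   =
      centre-mid⇒all Mc (in-M Mc Mu mid∼centre (legs-apart (another-≢ p i)))
    centre-other⇒all {just (_ , just (just ()))}

  spider-prime : IsPrime _∼_
  spider-prime M? mod {centre} u≢v Mu Mv = centre-other⇒all Mu Mv (u≢v ∘ ≡-sym)
    where open SpiderModule M? mod
  spider-prime M? mod {just _} u≢v Mu Mv = centre-other⇒all (centre∈ u≢v Mu Mv) Mu λ ()
    where open SpiderModule M? mod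

complete : (t : ℕ) → 2 ≤ t → Expr
complete t p = join t p (λ _ → bullet)

complete-⊒ : ∀ {t p} → _≢_ {A = Fin t} ⊑ Adj (complete t p)
complete-⊒ = record { map = _, tt ; adj⇔ = λ _ _ → mk⇔ join-out λ { (join-in ()) ; (join-out i≢j) → i≢j } }

2≤2+ : ∀ n → 2 ≤ 2 + n
2≤2+ n = s≤s (s≤s z≤n)

lemma27 : (k h : ℕ) → Σ Graph (λ G → ¬ InTD k G × ¬ InMW h G × InMTD 3 G)
lemma27 k h = graph blowup , ∉TD , ∉MW , ∈MTD
  where
  star blowup : Expr
  star   = spider (2 + h) (2≤2+ h)
  blowup = subst (graph star) (λ _ → complete (2 + k) (2≤2+ k))

  ∉TD : ¬ InTD k (graph blowup)
  ∉TD = clique⇒∉TD (graph blowup) (s≤s (n≤1+n k))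
          (complete-⊒ ⊚ subst-part-⊑ zero ⊚ realises⇒⊑ (graph-realises blowup))

  ∉MW : ¬ InMW h (graph blowup)
  ∉MW = prime⇒∉MW (spider-≟ (2≤2+ h)) (spider-prime (2≤2+ h))
          (centre∼mid (2≤2+ h) {zero}) (λ ()) (centre≁leaf (2≤2+ h) {zero})
          (s≤s (n≤1+n h)) (leaves (2≤2+ h)) (graph blowup)
          (realises⇒⊑ (graph-realises star) ⊚ subst-transversal-⊑ (λ _ → zero , tt)
                                            ⊚ realises⇒⊑ (graph-realises blowup))

  ∈MTD : InMTD 3 (graph blowup)
  ∈MTD = inj₂ (blowup , (star∈TD₃ , λ _ _ → tt) , graph-realises blowup)
    where
    star∈TD₃ : InTD 3 (graph star)
    star∈TD₃ = inj₂ (star , ((λ _ → tt) , s≤s (maxFin-≤ (2 + h) _ λ _ → s≤s (s≤s z≤n))) , graph-realises star)
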